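{- Let $p$ be a prime, $k\geq 1$, $j\geq 0$, and $r$ an integer with $1\leq r\leq p-1$. If $d_k(pn+r)\equiv 0\pmod p$ for all $n\geq 0$, then $d_{pj+k}(pn+r)\equiv 0\pmod p$ for all $n\geq 0$.
   Context: For each integer $k\geq 1$, the numbers $d_k(n)$ ($n\geq 0$) are defined by the generating function $\sum_{n\geq 0} d_k(n)q^n = \frac{f_2^k}{f_1^{3k+1}}$, where $f_r=\prod_{i\geq 1}(1-q^{ri})$. -}

module Defs where

open import Data.Nat as ℕ using (ℕ; zero; suc)
open import Data.Integer as ℤ using (ℤ; +_; 0ℤ; 1ℤ)
open import Data.List using (List; map; foldr; upTo)
open import Relation.Nullary.Decidable using (does)
open import Data.Bool using (if_then_else_)
open import Data.Nat.Divisibility using (_∣?_)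

Series : Set
Series = ℕ → ℤ

one : Series
one zero    = 1ℤ
one (suc _) = 0ℤ

_⊛_ : Series → Series → Series
(a ⊛ b) n = foldr ℤ._+_ 0ℤ (map (λ i → a i ℤ.* b (n ℕ.∸ i)) (upTo (suc n)))

pow : Series → ℕ → Series
pow a zero    = one
pow a (suc m) = a ⊛ pow a m

oneMinusQ : ℕ → Series
oneMinusQ j zero    = 1ℤ
oneMinusQ j (suc n) = if does (suc n ℕ.≟ j) then ℤ.- 1ℤ else 0ℤ

-- The series 1/(1 - q^j) = Σ_{m≥0} q^{jm}  (for j ≥ 1): coefficient of q^n is 1 iff j ∣ n.
geomQ : ℕ → Series
geomQ j n = if does (j ∣? n) then 1ℤ else 0ℤ

prodTo : ℕ → (ℕ → Series) → Series
prodTo zero    F = one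
prodTo (suc N) F = F (suc N) ⊛ prodTo N F

-- Factor for index i of  f₂^k / f₁^{3k+1} = ∏_{i≥1} (1 - q^{2i})^k · (1/(1 - q^i))^{3k+1}.
dFactor : ℕ → ℕ → Series
dFactor k i = pow (oneMinusQ (2 ℕ.* i)) k ⊛ pow (geomQ i) (3 ℕ.* k ℕ.+ 1)

-- d_k(n): coefficient of q^n in f₂^k / f₁^{3k+1}.  Factors with i > n are ≡ 1 mod q^{n+1},
-- so truncating the infinite product at i = n gives the exact coefficient.
d : ℕ → ℕ → ℤ
d k n = prodTo n (dFactor k) n

{-# OPTIONS --safe #-}
-- With θ = q d/dq, the generating function of d_{pj+k} factors as (f₂^k/f₁^{3k+1}) · S with
-- S = (f₂^j/f₁^{3j})^p.  Since θ(T^p) = p T^{p-1} θT, every coefficient m S(m) of θS is divisible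
-- by p, so p ∣ S(m) whenever p ∤ m.  In d_{pj+k}(pn+r) = Σ_i d_k(i) S(pn+r-i) each term has either
-- i ≡ r (mod p), and then p ∣ d_k(i) by hypothesis, or p ∤ pn+r-i, and then p ∣ S(pn+r-i).

module Submission where

open import Defs
open import Data.Nat using (ℕ; _+_; _*_; _∸_; _≤_)
open import Data.Nat.Primality using (Prime)
open import Data.Integer using (+_)
open import Data.Integer.Divisibility using (_∣_)

open import Data.Bool using (true; false; T)
open import Data.Empty using (⊥-elim)
open import Data.Integer using (ℤ; 0ℤ; 1ℤ) renaming (_+_ to _+ℤ_; _*_ to _*ℤ_)
import Data.Integer.Properties as ℤ
open import Data.Integer.Divisibility.Signed as Signed using () renaming (_∣_ to _∣ₛ_)
open import Data.Integer.Tactic.RingSolver using (solve-∀)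
open import Data.List using (foldr)
open import Data.List.Properties using (map-upTo; map-applyUpTo)
open import Data.Nat using (zero; suc; _<_; _≡ᵇ_; _≤′_; ≤′-refl; ≤′-step; z≤n; s≤s; NonZero)
import Data.Nat.Properties as ℕ
open import Data.Nat.DivMod using (_%_; _/_; m≡m%n+[m/n]*n; [m+kn]%n≡m%n; m<n⇒m%n≡m)
open import Data.Nat.Divisibility using (_∣?_; divides; _∣0; >⇒∤) renaming (_∣_ to _∣ℕ_)
open import Data.Nat.Primality using (euclidsLemma; prime⇒nonZero)
import Data.Nat.Tactic.RingSolver as ℕ-Solver
open import Data.Sum using (_⊎_; inj₁; inj₂; [_,_]′)
open import Data.Unit using (tt)
open import Relation.Binary.PropositionalEquality
open import Relation.Nullary using (¬_; yes; no)
open import Relation.Nullary.Negation using (contradiction)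
open ≡-Reasoning

infixl 6 _⊕_
infixr 7 _·_

0ₛ : Series
0ₛ _ = 0ℤ

_⊕_ : Series → Series → Series
(a ⊕ b) n = a n +ℤ b n

_·_ : ℤ → Series → Series
(x · a) n = x *ℤ a n

tail : Series → Series
tail a n = a (suc n)

shift : Series → Series
shift a zero    = 0ℤ
shift a (suc n) = a n

⊛-at-zero : ∀ a b → (a ⊛ b) 0 ≡ a 0 *ℤ b 0
⊛-at-zero a b = ℤ.+-identityʳ _

⊛-at-suc : ∀ a b n → (a ⊛ b) (suc n) ≡ a 0 *ℤ b (suc n) +ℤ (tail a ⊛ b) n
⊛-at-suc a b n = cong (λ xs → a 0 *ℤ b (suc n) +ℤ foldr _+ℤ_ 0ℤ xs)
  (trans (map-applyUpTo suc (λ i → a i *ℤ b (suc n ∸ i)) (suc n))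
         (sym (map-upTo (λ i → tail a i *ℤ b (n ∸ i)) (suc n))))

⊛-cong-upTo : ∀ {a a′ b b′} n → (∀ l → l ≤ n → a l ≡ a′ l) → (∀ l → l ≤ n → b l ≡ b′ l) →
              (a ⊛ b) n ≡ (a′ ⊛ b′) n
⊛-cong-upTo {a} {a′} {b} {b′} zero a≡ b≡ = begin
  (a ⊛ b) 0      ≡⟨ ⊛-at-zero a b ⟩
  a 0 *ℤ b 0     ≡⟨ cong₂ _*ℤ_ (a≡ 0 z≤n) (b≡ 0 z≤n) ⟩
  a′ 0 *ℤ b′ 0   ≡⟨ ⊛-at-zero a′ b′ ⟨
  (a′ ⊛ b′) 0    ∎
⊛-cong-upTo {a} {a′} {b} {b′} (suc n) a≡ b≡ = begin
  (a ⊛ b) (suc n)                             ≡⟨ ⊛-at-suc a b n ⟩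
  a 0 *ℤ b (suc n) +ℤ (tail a ⊛ b) n          ≡⟨ cong₂ _+ℤ_ (cong₂ _*ℤ_ (a≡ 0 z≤n) (b≡ (suc n) ℕ.≤-refl)) tails ⟩
  a′ 0 *ℤ b′ (suc n) +ℤ (tail a′ ⊛ b′) n      ≡⟨ ⊛-at-suc a′ b′ n ⟨
  (a′ ⊛ b′) (suc n)                           ∎
  where
  tails : (tail a ⊛ b) n ≡ (tail a′ ⊛ b′) n
  tails = ⊛-cong-upTo n (λ l l≤n → a≡ (suc l) (s≤s l≤n)) (λ l l≤n → b≡ l (ℕ.m≤n⇒m≤1+n l≤n))

⊛-cong : ∀ {a a′ b b′} → a ≗ a′ → b ≗ b′ → a ⊛ b ≗ a′ ⊛ b′
⊛-cong a≗ b≗ n = ⊛-cong-upTo n (λ l _ → a≗ l) (λ l _ → b≗ l)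

⊛-congˡ : ∀ {a a′} b → a ≗ a′ → a ⊛ b ≗ a′ ⊛ b
⊛-congˡ {a} {a′} b a≗ = ⊛-cong {a} {a′} {b} {b} a≗ (λ _ → refl)

⊛-congʳ : ∀ a {b b′} → b ≗ b′ → a ⊛ b ≗ a ⊛ b′
⊛-congʳ a {b} {b′} b≗ = ⊛-cong {a} {a} {b} {b′} (λ _ → refl) b≗

⊛-zeroˡ : ∀ b → 0ₛ ⊛ b ≗ 0ₛ
⊛-zeroˡ b zero    = trans (⊛-at-zero 0ₛ b) (ℤ.*-zeroˡ (b 0))
⊛-zeroˡ b (suc n) = trans (⊛-at-suc 0ₛ b n) (cong (0ℤ +ℤ_) (⊛-zeroˡ b n))

⊛-zeroʳ : ∀ a → a ⊛ 0ₛ ≗ 0ₛ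
⊛-zeroʳ a zero    = trans (⊛-at-zero a 0ₛ) (ℤ.*-zeroʳ (a 0))
⊛-zeroʳ a (suc n) = trans (⊛-at-suc a 0ₛ n) (cong₂ _+ℤ_ (ℤ.*-zeroʳ (a 0)) (⊛-zeroʳ (tail a) n))

⊛-identityˡ : ∀ b → one ⊛ b ≗ b
⊛-identityˡ b zero    = trans (⊛-at-zero one b) (ℤ.*-identityˡ (b 0))
⊛-identityˡ b (suc n) = begin
  (one ⊛ b) (suc n)                   ≡⟨ ⊛-at-suc one b n ⟩
  1ℤ *ℤ b (suc n) +ℤ (0ₛ ⊛ b) n       ≡⟨ cong (1ℤ *ℤ b (suc n) +ℤ_) (⊛-zeroˡ b n) ⟩
  1ℤ *ℤ b (suc n) +ℤ 0ℤ               ≡⟨ ℤ.+-identityʳ _ ⟩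
  1ℤ *ℤ b (suc n)                     ≡⟨ ℤ.*-identityˡ _ ⟩
  b (suc n)                           ∎

⊛-identityʳ : ∀ a → a ⊛ one ≗ a
⊛-identityʳ a zero    = trans (⊛-at-zero a one) (ℤ.*-identityʳ (a 0))
⊛-identityʳ a (suc n) = begin
  (a ⊛ one) (suc n)                   ≡⟨ ⊛-at-suc a one n ⟩
  a 0 *ℤ 0ℤ +ℤ (tail a ⊛ one) n       ≡⟨ cong₂ _+ℤ_ (ℤ.*-zeroʳ (a 0)) (⊛-identityʳ (tail a) n) ⟩
  0ℤ +ℤ a (suc n)                     ≡⟨ ℤ.+-identityˡ _ ⟩
  a (suc n)                           ∎

⊛-distribʳ-⊕ : ∀ b a c → (a ⊕ c) ⊛ b ≗ a ⊛ b ⊕ c ⊛ b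
⊛-distribʳ-⊕ b a c zero    = begin
  ((a ⊕ c) ⊛ b) 0                ≡⟨ ⊛-at-zero (a ⊕ c) b ⟩
  (a 0 +ℤ c 0) *ℤ b 0            ≡⟨ ℤ.*-distribʳ-+ (b 0) (a 0) (c 0) ⟩
  a 0 *ℤ b 0 +ℤ c 0 *ℤ b 0       ≡⟨ cong₂ _+ℤ_ (⊛-at-zero a b) (⊛-at-zero c b) ⟨
  (a ⊛ b) 0 +ℤ (c ⊛ b) 0         ∎
⊛-distribʳ-⊕ b a c (suc n) = begin
  ((a ⊕ c) ⊛ b) (suc n)
    ≡⟨ ⊛-at-suc (a ⊕ c) b n ⟩
  (a 0 +ℤ c 0) *ℤ b (suc n) +ℤ ((tail a ⊕ tail c) ⊛ b) n
    ≡⟨ cong ((a 0 +ℤ c 0) *ℤ b (suc n) +ℤ_) (⊛-distribʳ-⊕ b (tail a) (tail c) n) ⟩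
  (a 0 +ℤ c 0) *ℤ b (suc n) +ℤ ((tail a ⊛ b) n +ℤ (tail c ⊛ b) n)
    ≡⟨ regroup (a 0) (c 0) (b (suc n)) _ _ ⟩
  (a 0 *ℤ b (suc n) +ℤ (tail a ⊛ b) n) +ℤ (c 0 *ℤ b (suc n) +ℤ (tail c ⊛ b) n)
    ≡⟨ cong₂ _+ℤ_ (⊛-at-suc a b n) (⊛-at-suc c b n) ⟨
  (a ⊛ b) (suc n) +ℤ (c ⊛ b) (suc n)
    ∎
  where
  regroup : ∀ x y z u v → (x +ℤ y) *ℤ z +ℤ (u +ℤ v) ≡ (x *ℤ z +ℤ u) +ℤ (y *ℤ z +ℤ v)
  regroup = solve-∀

⊛-distribˡ-⊕ : ∀ a b c → a ⊛ (b ⊕ c) ≗ a ⊛ b ⊕ a ⊛ c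
⊛-distribˡ-⊕ a b c zero    = begin
  (a ⊛ (b ⊕ c)) 0                ≡⟨ ⊛-at-zero a (b ⊕ c) ⟩
  a 0 *ℤ (b 0 +ℤ c 0)            ≡⟨ ℤ.*-distribˡ-+ (a 0) (b 0) (c 0) ⟩
  a 0 *ℤ b 0 +ℤ a 0 *ℤ c 0       ≡⟨ cong₂ _+ℤ_ (⊛-at-zero a b) (⊛-at-zero a c) ⟨
  (a ⊛ b) 0 +ℤ (a ⊛ c) 0         ∎
⊛-distribˡ-⊕ a b c (suc n) = begin
  (a ⊛ (b ⊕ c)) (suc n)
    ≡⟨ ⊛-at-suc a (b ⊕ c) n ⟩
  a 0 *ℤ (b (suc n) +ℤ c (suc n)) +ℤ (tail a ⊛ (b ⊕ c)) n
    ≡⟨ cong (a 0 *ℤ (b (suc n) +ℤ c (suc n)) +ℤ_) (⊛-distribˡ-⊕ (tail a) b c n) ⟩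
  a 0 *ℤ (b (suc n) +ℤ c (suc n)) +ℤ ((tail a ⊛ b) n +ℤ (tail a ⊛ c) n)
    ≡⟨ regroup (a 0) (b (suc n)) (c (suc n)) _ _ ⟩
  (a 0 *ℤ b (suc n) +ℤ (tail a ⊛ b) n) +ℤ (a 0 *ℤ c (suc n) +ℤ (tail a ⊛ c) n)
    ≡⟨ cong₂ _+ℤ_ (⊛-at-suc a b n) (⊛-at-suc a c n) ⟨
  (a ⊛ b) (suc n) +ℤ (a ⊛ c) (suc n)
    ∎
  where
  regroup : ∀ x y z u v → x *ℤ (y +ℤ z) +ℤ (u +ℤ v) ≡ (x *ℤ y +ℤ u) +ℤ (x *ℤ z +ℤ v)
  regroup = solve-∀

·-⊛ : ∀ x a b → (x · a) ⊛ b ≗ x · (a ⊛ b)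
·-⊛ x a b zero    = trans (⊛-at-zero (x · a) b) (trans (ℤ.*-assoc x (a 0) (b 0)) (cong (x *ℤ_) (sym (⊛-at-zero a b))))
·-⊛ x a b (suc n) = begin
  ((x · a) ⊛ b) (suc n)                          ≡⟨ ⊛-at-suc (x · a) b n ⟩
  x *ℤ a 0 *ℤ b (suc n) +ℤ ((x · tail a) ⊛ b) n  ≡⟨ cong (x *ℤ a 0 *ℤ b (suc n) +ℤ_) (·-⊛ x (tail a) b n) ⟩
  x *ℤ a 0 *ℤ b (suc n) +ℤ x *ℤ (tail a ⊛ b) n   ≡⟨ factor x (a 0) (b (suc n)) _ ⟩
  x *ℤ (a 0 *ℤ b (suc n) +ℤ (tail a ⊛ b) n)      ≡⟨ cong (x *ℤ_) (⊛-at-suc a b n) ⟨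
  x *ℤ (a ⊛ b) (suc n)                           ∎
  where
  factor : ∀ x y z u → x *ℤ y *ℤ z +ℤ x *ℤ u ≡ x *ℤ (y *ℤ z +ℤ u)
  factor = solve-∀

⊛-· : ∀ x a b → a ⊛ (x · b) ≗ x · (a ⊛ b)
⊛-· x a b zero    = trans (⊛-at-zero a (x · b)) (trans (swap x (a 0) (b 0)) (cong (x *ℤ_) (sym (⊛-at-zero a b))))
  where
  swap : ∀ x y z → y *ℤ (x *ℤ z) ≡ x *ℤ (y *ℤ z)
  swap = solve-∀
⊛-· x a b (suc n) = begin
  (a ⊛ (x · b)) (suc n)                           ≡⟨ ⊛-at-suc a (x · b) n ⟩
  a 0 *ℤ (x *ℤ b (suc n)) +ℤ (tail a ⊛ (x · b)) n ≡⟨ cong (a 0 *ℤ (x *ℤ b (suc n)) +ℤ_) (⊛-· x (tail a) b n) ⟩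
  a 0 *ℤ (x *ℤ b (suc n)) +ℤ x *ℤ (tail a ⊛ b) n  ≡⟨ factor x (a 0) (b (suc n)) _ ⟩
  x *ℤ (a 0 *ℤ b (suc n) +ℤ (tail a ⊛ b) n)       ≡⟨ cong (x *ℤ_) (⊛-at-suc a b n) ⟨
  x *ℤ (a ⊛ b) (suc n)                            ∎
  where
  factor : ∀ x y z u → y *ℤ (x *ℤ z) +ℤ x *ℤ u ≡ x *ℤ (y *ℤ z +ℤ u)
  factor = solve-∀

⊛-shift : ∀ a b → a ⊛ shift b ≗ shift (a ⊛ b)
⊛-shift a b zero          = trans (⊛-at-zero a (shift b)) (ℤ.*-zeroʳ (a 0))
⊛-shift a b (suc zero)    = begin
  (a ⊛ shift b) 1                      ≡⟨ ⊛-at-suc a (shift b) 0 ⟩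
  a 0 *ℤ b 0 +ℤ (tail a ⊛ shift b) 0   ≡⟨ cong (a 0 *ℤ b 0 +ℤ_) (⊛-shift (tail a) b 0) ⟩
  a 0 *ℤ b 0 +ℤ 0ℤ                     ≡⟨ ℤ.+-identityʳ _ ⟩
  a 0 *ℤ b 0                           ≡⟨ ⊛-at-zero a b ⟨
  (a ⊛ b) 0                            ∎
⊛-shift a b (suc (suc n)) = begin
  (a ⊛ shift b) (2 + n)                          ≡⟨ ⊛-at-suc a (shift b) (suc n) ⟩
  a 0 *ℤ b (suc n) +ℤ (tail a ⊛ shift b) (suc n) ≡⟨ cong (a 0 *ℤ b (suc n) +ℤ_) (⊛-shift (tail a) b (suc n)) ⟩
  a 0 *ℤ b (suc n) +ℤ (tail a ⊛ b) n             ≡⟨ ⊛-at-suc a b n ⟨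
  (a ⊛ b) (suc n)                                ∎

head-⊕-shift-tail : ∀ a → a ≗ a 0 · one ⊕ shift (tail a)
head-⊕-shift-tail a zero    = sym (trans (ℤ.+-identityʳ _) (ℤ.*-identityʳ (a 0)))
head-⊕-shift-tail a (suc n) = sym (trans (cong (_+ℤ a (suc n)) (ℤ.*-zeroʳ (a 0))) (ℤ.+-identityˡ _))

⊛-comm : ∀ a b → a ⊛ b ≗ b ⊛ a
⊛-comm a b zero    = trans (⊛-at-zero a b) (trans (ℤ.*-comm (a 0) (b 0)) (sym (⊛-at-zero b a)))
⊛-comm a b (suc n) = begin
  (a ⊛ b) (suc n)
    ≡⟨ ⊛-at-suc a b n ⟩
  a 0 *ℤ b (suc n) +ℤ (tail a ⊛ b) n
    ≡⟨ cong₂ _+ℤ_ (cong (a 0 *ℤ_) (⊛-identityʳ b (suc n))) (⊛-comm b (tail a) n) ⟨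
  a 0 *ℤ (b ⊛ one) (suc n) +ℤ (b ⊛ tail a) n
    ≡⟨ cong₂ _+ℤ_ (⊛-· (a 0) b one (suc n)) (⊛-shift b (tail a) (suc n)) ⟨
  (b ⊛ (a 0 · one)) (suc n) +ℤ (b ⊛ shift (tail a)) (suc n)
    ≡⟨ ⊛-distribˡ-⊕ b (a 0 · one) (shift (tail a)) (suc n) ⟨
  (b ⊛ (a 0 · one ⊕ shift (tail a))) (suc n)
    ≡⟨ ⊛-congʳ b (head-⊕-shift-tail a) (suc n) ⟨
  (b ⊛ a) (suc n)
    ∎

⊛-assoc : ∀ a b c → (a ⊛ b) ⊛ c ≗ a ⊛ (b ⊛ c)
⊛-assoc a b c zero = begin
  ((a ⊛ b) ⊛ c) 0           ≡⟨ ⊛-at-zero (a ⊛ b) c ⟩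
  (a ⊛ b) 0 *ℤ c 0          ≡⟨ cong (_*ℤ c 0) (⊛-at-zero a b) ⟩
  a 0 *ℤ b 0 *ℤ c 0         ≡⟨ ℤ.*-assoc (a 0) (b 0) (c 0) ⟩
  a 0 *ℤ (b 0 *ℤ c 0)       ≡⟨ cong (a 0 *ℤ_) (⊛-at-zero b c) ⟨
  a 0 *ℤ (b ⊛ c) 0          ≡⟨ ⊛-at-zero a (b ⊛ c) ⟨
  (a ⊛ (b ⊛ c)) 0           ∎
⊛-assoc a b c (suc n) = begin
  ((a ⊛ b) ⊛ c) (suc n)
    ≡⟨ ⊛-at-suc (a ⊛ b) c n ⟩
  (a ⊛ b) 0 *ℤ c (suc n) +ℤ (tail (a ⊛ b) ⊛ c) n
    ≡⟨ cong₂ _+ℤ_ (cong (_*ℤ c (suc n)) (⊛-at-zero a b)) (⊛-congˡ c (⊛-at-suc a b) n) ⟩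
  a 0 *ℤ b 0 *ℤ c (suc n) +ℤ ((a 0 · tail b ⊕ tail a ⊛ b) ⊛ c) n
    ≡⟨ cong (a 0 *ℤ b 0 *ℤ c (suc n) +ℤ_) (⊛-distribʳ-⊕ c (a 0 · tail b) (tail a ⊛ b) n) ⟩
  a 0 *ℤ b 0 *ℤ c (suc n) +ℤ (((a 0 · tail b) ⊛ c) n +ℤ ((tail a ⊛ b) ⊛ c) n)
    ≡⟨ cong (a 0 *ℤ b 0 *ℤ c (suc n) +ℤ_) (cong₂ _+ℤ_ (·-⊛ (a 0) (tail b) c n) (⊛-assoc (tail a) b c n)) ⟩
  a 0 *ℤ b 0 *ℤ c (suc n) +ℤ (a 0 *ℤ (tail b ⊛ c) n +ℤ (tail a ⊛ (b ⊛ c)) n)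
    ≡⟨ regroup (a 0) (b 0) (c (suc n)) _ _ ⟩
  a 0 *ℤ (b 0 *ℤ c (suc n) +ℤ (tail b ⊛ c) n) +ℤ (tail a ⊛ (b ⊛ c)) n
    ≡⟨ cong (λ e → a 0 *ℤ e +ℤ (tail a ⊛ (b ⊛ c)) n) (⊛-at-suc b c n) ⟨
  a 0 *ℤ (b ⊛ c) (suc n) +ℤ (tail a ⊛ (b ⊛ c)) n
    ≡⟨ ⊛-at-suc a (b ⊛ c) n ⟨
  (a ⊛ (b ⊛ c)) (suc n)
    ∎
  where
  regroup : ∀ x y z u v → x *ℤ y *ℤ z +ℤ (x *ℤ u +ℤ v) ≡ x *ℤ (y *ℤ z +ℤ u) +ℤ v
  regroup = solve-∀

⊛-interchange : ∀ w x y z → (w ⊛ x) ⊛ (y ⊛ z) ≗ (w ⊛ y) ⊛ (x ⊛ z)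
⊛-interchange w x y z n = begin
  ((w ⊛ x) ⊛ (y ⊛ z)) n   ≡⟨ ⊛-assoc w x (y ⊛ z) n ⟩
  (w ⊛ (x ⊛ (y ⊛ z))) n   ≡⟨ ⊛-congʳ w (λ m → sym (⊛-assoc x y z m)) n ⟩
  (w ⊛ ((x ⊛ y) ⊛ z)) n   ≡⟨ ⊛-congʳ w (⊛-congˡ z (⊛-comm x y)) n ⟩
  (w ⊛ ((y ⊛ x) ⊛ z)) n   ≡⟨ ⊛-congʳ w (⊛-assoc y x z) n ⟩
  (w ⊛ (y ⊛ (x ⊛ z))) n   ≡⟨ ⊛-assoc w y (x ⊛ z) n ⟨
  ((w ⊛ y) ⊛ (x ⊛ z)) n   ∎

pow-+ : ∀ a m n → pow a (m + n) ≗ pow a m ⊛ pow a n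
pow-+ a zero    n k = sym (⊛-identityˡ (pow a n) k)
pow-+ a (suc m) n k = trans (⊛-congʳ a (pow-+ a m n) k) (sym (⊛-assoc a (pow a m) (pow a n) k))

pow-* : ∀ a m n → pow a (m * n) ≗ pow (pow a m) n
pow-* a m zero    k = cong (λ e → pow a e k) (ℕ.*-zeroʳ m)
pow-* a m (suc n) k = begin
  pow a (m * suc n) k              ≡⟨ cong (λ e → pow a e k) (ℕ.*-suc m n) ⟩
  pow a (m + m * n) k              ≡⟨ pow-+ a m (m * n) k ⟩
  (pow a m ⊛ pow a (m * n)) k      ≡⟨ ⊛-congʳ (pow a m) (pow-* a m n) k ⟩
  (pow a m ⊛ pow (pow a m) n) k    ∎

pow-*-+ : ∀ a p j k → pow a (p * j + k) ≗ pow (pow a p) j ⊛ pow a k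
pow-*-+ a p j k n = trans (pow-+ a (p * j) k n) (⊛-congˡ (pow a k) (pow-* a p j) n)

θ : Series → Series
θ a n = + n *ℤ a n

θ-one : θ one ≗ 0ₛ
θ-one zero    = refl
θ-one (suc n) = ℤ.*-zeroʳ (+ suc n)

θ-tail : ∀ a → tail (θ a) ≗ θ (tail a) ⊕ tail a
θ-tail a n = trans (cong (_*ℤ a (suc n)) (ℤ.pos-+ 1 n)) (split (+ n) (a (suc n)))
  where
  split : ∀ N x → (+ 1 +ℤ N) *ℤ x ≡ N *ℤ x +ℤ x
  split = solve-∀

θ-⊛ : ∀ a b → θ (a ⊛ b) ≗ θ a ⊛ b ⊕ a ⊛ θ b
θ-⊛ a b zero = begin
  + 0 *ℤ (a ⊛ b) 0                       ≡⟨ cong (+ 0 *ℤ_) (⊛-at-zero a b) ⟩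
  + 0 *ℤ (a 0 *ℤ b 0)                    ≡⟨ zero-terms (a 0) (b 0) ⟩
  + 0 *ℤ a 0 *ℤ b 0 +ℤ a 0 *ℤ (+ 0 *ℤ b 0)
    ≡⟨ cong₂ _+ℤ_ (⊛-at-zero (θ a) b) (⊛-at-zero a (θ b)) ⟨
  (θ a ⊛ b) 0 +ℤ (a ⊛ θ b) 0             ∎
  where
  zero-terms : ∀ x y → + 0 *ℤ (x *ℤ y) ≡ + 0 *ℤ x *ℤ y +ℤ x *ℤ (+ 0 *ℤ y)
  zero-terms = solve-∀
θ-⊛ a b (suc n) = begin
  + suc n *ℤ (a ⊛ b) (suc n)
    ≡⟨ cong₂ _*ℤ_ (ℤ.pos-+ 1 n) (⊛-at-suc a b n) ⟩
  (+ 1 +ℤ + n) *ℤ (a₀ *ℤ b′ +ℤ rest)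
    ≡⟨ expand (+ n) a₀ b′ rest ⟩
  (+ 1 +ℤ + n) *ℤ (a₀ *ℤ b′) +ℤ rest +ℤ + n *ℤ rest
    ≡⟨ cong ((+ 1 +ℤ + n) *ℤ (a₀ *ℤ b′) +ℤ rest +ℤ_) (θ-⊛ (tail a) b n) ⟩
  (+ 1 +ℤ + n) *ℤ (a₀ *ℤ b′) +ℤ rest +ℤ ((θ (tail a) ⊛ b) n +ℤ (tail a ⊛ θ b) n)
    ≡⟨ regroup (+ n) a₀ b′ rest ((θ (tail a) ⊛ b) n) ((tail a ⊛ θ b) n) ⟩
  + 0 *ℤ a₀ *ℤ b′ +ℤ ((θ (tail a) ⊛ b) n +ℤ rest) +ℤ (a₀ *ℤ ((+ 1 +ℤ + n) *ℤ b′) +ℤ (tail a ⊛ θ b) n)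
    ≡⟨ cong₂ (λ x y → + 0 *ℤ a₀ *ℤ b′ +ℤ x +ℤ (a₀ *ℤ (y *ℤ b′) +ℤ (tail a ⊛ θ b) n))
             (⊛-distribʳ-⊕ b (θ (tail a)) (tail a) n) (ℤ.pos-+ 1 n) ⟨
  + 0 *ℤ a₀ *ℤ b′ +ℤ ((θ (tail a) ⊕ tail a) ⊛ b) n +ℤ (a₀ *ℤ θ b (suc n) +ℤ (tail a ⊛ θ b) n)
    ≡⟨ cong₂ _+ℤ_ (cong (+ 0 *ℤ a₀ *ℤ b′ +ℤ_) (⊛-congˡ b (θ-tail a) n)) refl ⟨
  + 0 *ℤ a₀ *ℤ b′ +ℤ (tail (θ a) ⊛ b) n +ℤ (a₀ *ℤ θ b (suc n) +ℤ (tail a ⊛ θ b) n)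
    ≡⟨ cong₂ _+ℤ_ (⊛-at-suc (θ a) b n) (⊛-at-suc a (θ b) n) ⟨
  (θ a ⊛ b) (suc n) +ℤ (a ⊛ θ b) (suc n)
    ∎
  where
  a₀ = a 0
  b′ = b (suc n)
  rest = (tail a ⊛ b) n
  expand : ∀ N x y t → (+ 1 +ℤ N) *ℤ (x *ℤ y +ℤ t) ≡ (+ 1 +ℤ N) *ℤ (x *ℤ y) +ℤ t +ℤ N *ℤ t
  expand = solve-∀
  regroup : ∀ N x y t u v → (+ 1 +ℤ N) *ℤ (x *ℤ y) +ℤ t +ℤ (u +ℤ v)
                          ≡ + 0 *ℤ x *ℤ y +ℤ (u +ℤ t) +ℤ (x *ℤ ((+ 1 +ℤ N) *ℤ y) +ℤ v)
  regroup = solve-∀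

θ-pow : ∀ a m → θ (pow a (suc m)) ≗ + suc m · (θ a ⊛ pow a m)
θ-pow a zero k = begin
  θ (a ⊛ one) k                       ≡⟨ θ-⊛ a one k ⟩
  (θ a ⊛ one) k +ℤ (a ⊛ θ one) k      ≡⟨ cong ((θ a ⊛ one) k +ℤ_) (trans (⊛-congʳ a θ-one k) (⊛-zeroʳ a k)) ⟩
  (θ a ⊛ one) k +ℤ 0ℤ                 ≡⟨ ℤ.+-identityʳ _ ⟩
  (θ a ⊛ one) k                       ≡⟨ ℤ.*-identityˡ _ ⟨
  + 1 *ℤ (θ a ⊛ one) k                ∎
θ-pow a (suc m) k = begin
  θ (a ⊛ aᵐ⁺¹) k
    ≡⟨ θ-⊛ a aᵐ⁺¹ k ⟩
  (θ a ⊛ aᵐ⁺¹) k +ℤ (a ⊛ θ aᵐ⁺¹) k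
    ≡⟨ cong ((θ a ⊛ aᵐ⁺¹) k +ℤ_) (trans (⊛-congʳ a (θ-pow a m) k) (⊛-· (+ suc m) a (θ a ⊛ pow a m) k)) ⟩
  (θ a ⊛ aᵐ⁺¹) k +ℤ + suc m *ℤ (a ⊛ (θ a ⊛ pow a m)) k
    ≡⟨ cong (λ e → (θ a ⊛ aᵐ⁺¹) k +ℤ + suc m *ℤ e) move-θ ⟩
  (θ a ⊛ aᵐ⁺¹) k +ℤ + suc m *ℤ (θ a ⊛ aᵐ⁺¹) k
    ≡⟨ collect (+ suc m) _ ⟩
  (+ 1 +ℤ + suc m) *ℤ (θ a ⊛ aᵐ⁺¹) k
    ≡⟨ cong (_*ℤ (θ a ⊛ aᵐ⁺¹) k) (ℤ.pos-+ 1 (suc m)) ⟨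
  + suc (suc m) *ℤ (θ a ⊛ aᵐ⁺¹) k
    ∎
  where
  aᵐ⁺¹ = pow a (suc m)
  move-θ : (a ⊛ (θ a ⊛ pow a m)) k ≡ (θ a ⊛ aᵐ⁺¹) k
  move-θ = begin
    (a ⊛ (θ a ⊛ pow a m)) k    ≡⟨ ⊛-assoc a (θ a) (pow a m) k ⟨
    ((a ⊛ θ a) ⊛ pow a m) k    ≡⟨ ⊛-congˡ (pow a m) (⊛-comm a (θ a)) k ⟩
    ((θ a ⊛ a) ⊛ pow a m) k    ≡⟨ ⊛-assoc (θ a) a (pow a m) k ⟩
    (θ a ⊛ aᵐ⁺¹) k             ∎
  collect : ∀ c y → y +ℤ c *ℤ y ≡ (+ 1 +ℤ c) *ℤ y
  collect = solve-∀

∣⊎∣⇒∣* : ∀ {z} x y → z ∣ₛ x ⊎ z ∣ₛ y → z ∣ₛ x *ℤ y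
∣⊎∣⇒∣* x y = [ Signed.∣m⇒∣m*n y , Signed.∣n⇒∣m*n x ]′

∣-⊛-at : ∀ {z} a b n → (∀ i → i ≤ n → z ∣ₛ a i ⊎ z ∣ₛ b (n ∸ i)) → z ∣ₛ (a ⊛ b) n
∣-⊛-at {z} a b zero    h = subst (z ∣ₛ_) (sym (⊛-at-zero a b)) (∣⊎∣⇒∣* _ _ (h 0 z≤n))
∣-⊛-at {z} a b (suc n) h = subst (z ∣ₛ_) (sym (⊛-at-suc a b n))
  (Signed.∣m∣n⇒∣m+n (∣⊎∣⇒∣* _ _ (h 0 z≤n)) (∣-⊛-at (tail a) b n (λ i i≤n → h (suc i) (s≤s i≤n))))

infix 4 _∣θ_
_∣θ_ : ℤ → Series → Set
z ∣θ a = ∀ n → z ∣ₛ θ a n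

∣θ-one : ∀ z → z ∣θ one
∣θ-one z n = subst (z ∣ₛ_) (sym (θ-one n)) (Signed.divides 0ℤ (sym (ℤ.*-zeroˡ z)))

∣θ-⊛ : ∀ {z a b} → z ∣θ a → z ∣θ b → z ∣θ a ⊛ b
∣θ-⊛ {z} {a} {b} z∣θa z∣θb n = subst (z ∣ₛ_) (sym (θ-⊛ a b n))
  (Signed.∣m∣n⇒∣m+n (∣-⊛-at (θ a) b n (λ i _ → inj₁ (z∣θa i)))
                     (∣-⊛-at a (θ b) n (λ i _ → inj₂ (z∣θb (n ∸ i)))))

∣θ-pow : ∀ {z a} → z ∣θ a → ∀ m → z ∣θ pow a m
∣θ-pow {z} z∣θa zero    = ∣θ-one z
∣θ-pow {z} z∣θa (suc m) = ∣θ-⊛ z∣θa (∣θ-pow z∣θa m)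

∣θ-prodTo : ∀ {z F} → (∀ i → z ∣θ F i) → ∀ N → z ∣θ prodTo N F
∣θ-prodTo {z} z∣θF zero    = ∣θ-one z
∣θ-prodTo {z} z∣θF (suc N) = ∣θ-⊛ (z∣θF (suc N)) (∣θ-prodTo z∣θF N)

∣θ-pow-self : ∀ m a → + m ∣θ pow a m
∣θ-pow-self zero    a = ∣θ-one (+ 0)
∣θ-pow-self (suc m) a n = subst (+ suc m ∣ₛ_) (sym (θ-pow a m n)) (Signed.∣m⇒∣m*n _ Signed.∣-refl)

∣θ⇒∣ : ∀ {p a n} → Prime p → + p ∣θ a → ¬ p ∣ℕ n → + p ∣ₛ a n
∣θ⇒∣ {p} {a} {n} p-prime p∣θa p∤n
  with euclidsLemma n _ p-prime (subst (p ∣ℕ_) (ℤ.abs-* (+ n) (a n)) (Signed.∣⇒∣ᵤ (p∣θa n)))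
... | inj₁ p∣n     = contradiction p∣n p∤n
... | inj₂ p∣∣a[n]∣ = Signed.∣ᵤ⇒∣ p∣∣a[n]∣

∣∸⇒≡residue : ∀ {p n r i} .{{_ : NonZero p}} → r < p → i ≤ p * n + r → p ∣ℕ p * n + r ∸ i →
              i ≡ p * (i / p) + r
∣∸⇒≡residue {p} {n} {r} {i} r<p i≤M (divides t M∸i≡tp) = begin
  i                  ≡⟨ m≡m%n+[m/n]*n i p ⟩
  i % p + i / p * p  ≡⟨ cong (_+ i / p * p) i%p≡r ⟩
  r + i / p * p      ≡⟨ ℕ.+-comm r _ ⟩
  i / p * p + r      ≡⟨ cong (_+ r) (ℕ.*-comm (i / p) p) ⟩
  p * (i / p) + r    ∎
  where
  i%p≡r : i % p ≡ r
  i%p≡r = begin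
    i % p                  ≡⟨ [m+kn]%n≡m%n i t p ⟨
    (i + t * p) % p        ≡⟨ cong (_% p) (trans (ℕ.+-comm i _) (cong (_+ i) (sym M∸i≡tp))) ⟩
    (p * n + r ∸ i + i) % p ≡⟨ cong (_% p) (ℕ.m∸n+n≡m i≤M) ⟩
    (p * n + r) % p        ≡⟨ cong (_% p) (trans (ℕ.+-comm (p * n) r) (cong (λ x → r + x) (ℕ.*-comm p n))) ⟩
    (r + n * p) % p        ≡⟨ [m+kn]%n≡m%n r n p ⟩
    r % p                  ≡⟨ m<n⇒m%n≡m r<p ⟩
    r                      ∎

∣-⊛-residue : ∀ {p r} a b → Prime p → r < p → + p ∣θ b →
              (∀ n → + p ∣ a (p * n + r)) → ∀ n → + p ∣ (a ⊛ b) (p * n + r)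
∣-⊛-residue {p} {r} a b p-prime r<p p∣θb p∣a n = Signed.∣⇒∣ᵤ (∣-⊛-at a b (p * n + r) p∣term)
  where
  instance
    p≢0 : NonZero p
    p≢0 = prime⇒nonZero p-prime
  p∣term : ∀ i → i ≤ p * n + r → + p ∣ₛ a i ⊎ + p ∣ₛ b (p * n + r ∸ i)
  p∣term i i≤M with p ∣? p * n + r ∸ i
  ... | yes p∣M∸i = inj₁ (subst (λ x → + p ∣ₛ a x) (sym (∣∸⇒≡residue r<p i≤M p∣M∸i))
                                (Signed.∣ᵤ⇒∣ (p∣a (i / p))))
  ... | no  p∤M∸i = inj₂ (∣θ⇒∣ p-prime p∣θb p∤M∸i)

TrivialBelow : ℕ → Series → Set
TrivialBelow i a = ∀ l → l < i → a l ≡ one l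

⊛-TrivialBelow : ∀ {i a} b → TrivialBelow i a → ∀ {m} → m < i → (a ⊛ b) m ≡ b m
⊛-TrivialBelow {i} {a} b a≡1 {m} m<i =
  trans (⊛-cong-upTo {a} {one} {b} {b} m (λ l l≤m → a≡1 l (ℕ.≤-<-trans l≤m m<i)) (λ _ _ → refl))
        (⊛-identityˡ b m)

TrivialBelow-⊛ : ∀ {i a b} → TrivialBelow i a → TrivialBelow i b → TrivialBelow i (a ⊛ b)
TrivialBelow-⊛ {b = b} a≡1 b≡1 l l<i = trans (⊛-TrivialBelow b a≡1 l<i) (b≡1 l l<i)

TrivialBelow-pow : ∀ {i a} → TrivialBelow i a → ∀ m → TrivialBelow i (pow a m)
TrivialBelow-pow a≡1 zero    l _ = refl
TrivialBelow-pow a≡1 (suc m)     = TrivialBelow-⊛ a≡1 (TrivialBelow-pow a≡1 m)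

TrivialBelow-mono : ∀ {i j a} → i ≤ j → TrivialBelow j a → TrivialBelow i a
TrivialBelow-mono i≤j a≡1 l l<i = a≡1 l (ℕ.<-≤-trans l<i i≤j)

TrivialBelow-oneMinusQ : ∀ j → TrivialBelow j (oneMinusQ j)
TrivialBelow-oneMinusQ j zero    _ = refl
TrivialBelow-oneMinusQ j (suc m) m<j with suc m ≡ᵇ j in eq
... | true  = contradiction (ℕ.≡ᵇ⇒≡ (suc m) j (subst T (sym eq) tt)) (ℕ.<⇒≢ m<j)
... | false = refl

TrivialBelow-geomQ : ∀ j → TrivialBelow j (geomQ j)
TrivialBelow-geomQ j zero    _ with j ∣? 0
... | yes _   = refl
... | no  j∤0 = contradiction (j ∣0) j∤0
TrivialBelow-geomQ j (suc m) m<j with j ∣? suc m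
... | yes j∣m = contradiction j∣m (>⇒∤ m<j)
... | no  _   = refl

TrivialBelow-oneMinusQ-double : ∀ i → TrivialBelow i (oneMinusQ (2 * i))
TrivialBelow-oneMinusQ-double i = TrivialBelow-mono (ℕ.m≤n*m i 2) (TrivialBelow-oneMinusQ (2 * i))

TrivialBelow-dFactor : ∀ k i → TrivialBelow i (dFactor k i)
TrivialBelow-dFactor k i = TrivialBelow-⊛
  (TrivialBelow-pow (TrivialBelow-oneMinusQ-double i) k)
  (TrivialBelow-pow (TrivialBelow-geomQ i) (3 * k + 1))

prodTo-stable : ∀ {F} → (∀ i → TrivialBelow i (F i)) → ∀ {m M} → m ≤′ M → prodTo M F m ≡ prodTo m F m
prodTo-stable F≡1 ≤′-refl = refl
prodTo-stable {F} F≡1 (≤′-step {M} m≤′M) =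
  trans (⊛-TrivialBelow (prodTo M F) (F≡1 (suc M)) (s≤s (ℕ.≤′⇒≤ m≤′M))) (prodTo-stable F≡1 m≤′M)

prodTo-cong : ∀ {F G} → (∀ i → F i ≗ G i) → ∀ N → prodTo N F ≗ prodTo N G
prodTo-cong F≗G zero    _ = refl
prodTo-cong F≗G (suc N)   = ⊛-cong (F≗G (suc N)) (prodTo-cong F≗G N)

prodTo-⊛ : ∀ F G N → prodTo N (λ i → F i ⊛ G i) ≗ prodTo N F ⊛ prodTo N G
prodTo-⊛ F G zero    n = sym (⊛-identityˡ one n)
prodTo-⊛ F G (suc N) n = trans (⊛-congʳ (F (suc N) ⊛ G (suc N)) (prodTo-⊛ F G N) n)
  (⊛-interchange (F (suc N)) (G (suc N)) (prodTo N F) (prodTo N G) n)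

-- ∏_{i≥1} F i, meaningful when F i ≡ 1 (mod qⁱ); d k is ∏ (dFactor k) by definition.
∏ : (ℕ → Series) → Series
∏ F n = prodTo n F n

∏-⊛ : ∀ {F G} → (∀ i → TrivialBelow i (F i)) → (∀ i → TrivialBelow i (G i)) →
      ∏ (λ i → F i ⊛ G i) ≗ ∏ F ⊛ ∏ G
∏-⊛ {F} {G} F≡1 G≡1 n = trans (prodTo-⊛ F G n n) (⊛-cong-upTo {prodTo n F} {∏ F} {prodTo n G} {∏ G} n
  (λ l l≤n → prodTo-stable F≡1 (ℕ.≤⇒≤′ l≤n)) (λ l l≤n → prodTo-stable G≡1 (ℕ.≤⇒≤′ l≤n)))

-- The i-th factor of (f₂^j / f₁^{3j})^p, with the p-th powers taken factorwise.
pthPowerFactor : ℕ → ℕ → ℕ → Series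
pthPowerFactor p j i = pow (pow (oneMinusQ (2 * i)) p) j ⊛ pow (pow (geomQ i) p) (3 * j)

dFactor-+ : ∀ p j k i → dFactor (p * j + k) i ≗ dFactor k i ⊛ pthPowerFactor p j i
dFactor-+ p j k i n = begin
  dFactor (p * j + k) i n
    ≡⟨ ⊛-cong (pow-*-+ A p j k) G-part n ⟩
  ((pow (pow A p) j ⊛ pow A k) ⊛ (pow (pow G p) (3 * j) ⊛ pow G (3 * k + 1))) n
    ≡⟨ ⊛-interchange (pow (pow A p) j) (pow A k) (pow (pow G p) (3 * j)) (pow G (3 * k + 1)) n ⟩
  (pthPowerFactor p j i ⊛ dFactor k i) n
    ≡⟨ ⊛-comm (pthPowerFactor p j i) (dFactor k i) n ⟩
  (dFactor k i ⊛ pthPowerFactor p j i) n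
    ∎
  where
  A = oneMinusQ (2 * i)
  G = geomQ i
  exponent : ∀ p j k → 3 * (p * j + k) + 1 ≡ p * (3 * j) + (3 * k + 1)
  exponent = ℕ-Solver.solve-∀
  G-part : pow G (3 * (p * j + k) + 1) ≗ pow (pow G p) (3 * j) ⊛ pow G (3 * k + 1)
  G-part m = trans (cong (λ e → pow G e m) (exponent p j k)) (pow-*-+ G p (3 * j) (3 * k + 1) m)

TrivialBelow-pthPowerFactor : ∀ p j i → TrivialBelow i (pthPowerFactor p j i)
TrivialBelow-pthPowerFactor p j i = TrivialBelow-⊛
  (TrivialBelow-pow (TrivialBelow-pow (TrivialBelow-oneMinusQ-double i) p) j)
  (TrivialBelow-pow (TrivialBelow-pow (TrivialBelow-geomQ i) p) (3 * j))

d-+ : ∀ p j k → d (p * j + k) ≗ d k ⊛ ∏ (pthPowerFactor p j)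
d-+ p j k n = trans (prodTo-cong (dFactor-+ p j k) n n)
  (∏-⊛ (TrivialBelow-dFactor k) (TrivialBelow-pthPowerFactor p j) n)

p∣θ∏pthPowerFactor : ∀ p j → + p ∣θ ∏ (pthPowerFactor p j)
p∣θ∏pthPowerFactor p j n = ∣θ-prodTo p∣θfactor n n
  where
  p∣θfactor : ∀ i → + p ∣θ pthPowerFactor p j i
  p∣θfactor i = ∣θ-⊛ (∣θ-pow (∣θ-pow-self p _) j) (∣θ-pow (∣θ-pow-self p _) (3 * j))

theorem4p4 : (p k j r : ℕ) → Prime p → 1 ≤ k → 1 ≤ r → r ≤ p ∸ 1 →
    (∀ n → + p ∣ d k (p * n + r)) →
    ∀ n → + p ∣ d (p * j + k) (p * n + r)
theorem4p4 zero k j r p-prime _ _ _ _ _ = ⊥-elim (NonZero.nonZero (prime⇒nonZero p-prime))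
theorem4p4 p@(suc _) k j r p-prime _ _ r≤p∸1 p∣dₖ n =
  subst (λ x → + p ∣ x) (sym (d-+ p j k (p * n + r)))
    (∣-⊛-residue (d k) (∏ (pthPowerFactor p j)) p-prime (s≤s r≤p∸1) (p∣θ∏pthPowerFactor p j) p∣dₖ n)
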